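{- Let $d\ge 2$ and $i_1,\dots,i_d\in\mathbb{N}$, and let $K_{i_1,\dots,i_d}$ be the complete $d$-partite graph whose vertex set is partitioned into parts of sizes $i_1,\dots,i_d$. Then for every valid colouring $c$ of $K_{i_1,\dots,i_d}$, the graph is $\min\{i_1,\dots,i_d\}$-local, i.e. $\operatorname{loc}(K_{i_1,\dots,i_d},c)\le\min\{i_1,\dots,i_d\}$.
   Context: The complete $d$-partite graph $K_{i_1,\dots,i_d}$ has vertex set $V_1\dot\cup\cdots\dot\cup V_d$ with $|V_j|=i_j$, two vertices being adjacent iff they lie in different parts. A colouring of $G=(V,E)$ is a function $c:V\to[\ell]$; valid means adjacent vertices get distinct colours. Let $\mathcal C(G,c)=c(V)$, $m=|\mathcal C(G,c)|$; a marking sequence is an enumeration $e=(x_1,\dots,x_m)$ of $\mathcal C(G,c)$; $G_i$ is the subgraph induced by the vertices with colours in $\{x_1,\dots,x_i\}$; with $\gamma(H)$ the number of connected components, $\operatorname{loc}(G,c,e)=\max_i\gamma(G_i)$, $\operatorname{loc}(G,c)=\min_e\operatorname{loc}(G,c,e)$. $G$ is $k$-local if $\operatorname{loc}(G,c)\le k$. -}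

module Defs where

open import Level using (0ℓ)
open import Data.Nat using (ℕ; zero; suc; _≤_; _⊓_)
import Data.Fin
open Data.Fin using (Fin)
open import Data.Product using (Σ; ∃; _×_; _,_; proj₁)
open import Data.List using (List; length; take)
open import Data.List.Membership.Propositional using (_∈_)
open import Data.List.Relation.Unary.Unique.Propositional using (Unique)
open import Relation.Binary.PropositionalEquality using (_≡_; _≢_)
open import Relation.Binary.Construct.Closure.ReflexiveTransitive using (Star)

Graph : Set → Set₁
Graph V = V → V → Set

InducedAdj : {V : Set} → Graph V → (P : V → Set) → Graph (Σ V P)
InducedAdj E P (u , _) (v , _) = E u v

Connected : {V : Set} → Graph V → (P : V → Set) → Σ V P → Σ V P → Set
Connected E P = Star (InducedAdj E P)

-- γ(G[P]) = n : there is a labelling of the vertices of G[P] by Fin n that is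
-- onto, and two vertices get the same label iff they lie in the same component.
-- (The components are thus in bijection with Fin n.)
HasComponents : {V : Set} → Graph V → (P : V → Set) → ℕ → Set
HasComponents E P n =
  Σ (Σ _ P → Fin n) λ f →
    ((k : Fin n) → ∃ λ u → f u ≡ k)
    × (∀ u v → f u ≡ f v → Connected E P u v)
    × (∀ u v → Connected E P u v → f u ≡ f v)

ComponentsAtMost : {V : Set} → Graph V → (P : V → Set) → ℕ → Set
ComponentsAtMost E P k = ∃ λ n → n ≤ k × HasComponents E P n

ValidColouring : {V : Set} → Graph V → {ℓ : ℕ} → (V → Fin ℓ) → Set
ValidColouring E c = ∀ u v → E u v → c u ≢ c v

IsMarkingSequence : {V : Set} {ℓ : ℕ} → (V → Fin ℓ) → List (Fin ℓ) → Set
IsMarkingSequence {V} c e =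
  Unique e
  × (∀ x → x ∈ e → ∃ λ (v : V) → c v ≡ x)
  × (∀ (v : V) → c v ∈ e)

PrefixVertices : {V : Set} {ℓ : ℕ} → (V → Fin ℓ) → List (Fin ℓ) → ℕ → V → Set
PrefixVertices c e i v = c v ∈ take i e

-- loc(G,c,e) ≤ k  (max over i = 1..m of γ(G_i) is ≤ k; i = 0 is harmless: γ = 0)
LocSeqAtMost : {V : Set} → Graph V → {ℓ : ℕ} → (V → Fin ℓ) → List (Fin ℓ) → ℕ → Set
LocSeqAtMost E c e k =
  ∀ i → i ≤ length e → ComponentsAtMost E (PrefixVertices c e i) k

LocAtMost : {V : Set} → Graph V → {ℓ : ℕ} → (V → Fin ℓ) → ℕ → Set
LocAtMost E c k = ∃ λ e → IsMarkingSequence c e × LocSeqAtMost E c e k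

KVertex : (d : ℕ) → (Fin d → ℕ) → Set
KVertex d i = Σ (Fin d) λ j → Fin (i j)

KGraph : (d : ℕ) → (i : Fin d → ℕ) → Graph (KVertex d i)
KGraph d i u v = proj₁ u ≢ proj₁ v

-- min{i_1,…,i_d} (value 0 for d = 0, irrelevant since d ≥ 2)
minOf : (d : ℕ) → (Fin d → ℕ) → ℕ
minOf zero i = 0
minOf (suc zero) i = i Data.Fin.zero
minOf (suc (suc d)) i = i Data.Fin.zero ⊓ minOf (suc d) (λ j → i (Data.Fin.suc j))

-- Let j be a smallest part, u a vertex of part j and u′ a vertex of another part,
-- and mark first the colour x of u, then the colour y of u′, then all other colours.
-- A valid colouring of a complete multipartite graph uses every colour inside a
-- single part, so G₁ is an independent set of at most i_j vertices of part j.
-- From step 2 on, G_k contains u and u′; since every vertex is adjacent to u or to u′,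
-- and u ~ u′, G_k is connected.
module Submission where

open import Defs
open import Data.Nat using (ℕ; zero; suc; _≤_; z≤n; s≤s)
open import Data.Nat.Properties using (≤-trans; ≤-total; n≤1+n; m≤n⇒m⊓n≡m; m≥n⇒m⊓n≡n)
open import Data.Fin using (Fin; _≟_; fromℕ<) renaming (zero to fzero; suc to fsuc)
open import Data.Fin.Properties using (suc-injective)
open import Data.Product using (Σ; ∃; _×_; _,_; proj₁; proj₂)
open import Data.Sum using (inj₁; inj₂)
open import Data.Empty using (⊥-elim)
open import Data.List using (List; []; _∷_; _++_; map; filter; concatMap; deduplicate; allFin)
open import Data.List.Membership.Propositional using (_∈_)
open import Data.List.Membership.Propositional.Properties
  using (∈-map⁺; ∈-map⁻; ∈-filter⁺; ∈-filter⁻; ∈-deduplicate⁺; ∈-deduplicate⁻; ∈-concatMap⁺; ∈-allFin; ∈-++⁺ˡ; ∈-++⁺ʳ; ∈-++⁻)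
open import Data.List.Relation.Unary.Any using (here; there)
import Data.List.Relation.Unary.Any as Any
open import Data.List.Relation.Unary.All using ([]; _∷_)
open import Data.List.Relation.Unary.AllPairs using ([]; _∷_)
open import Data.List.Relation.Unary.Unique.Propositional using (Unique)
open import Data.List.Relation.Unary.Unique.Propositional.Properties using (++⁺; filter⁺)
open import Axiom.UniquenessOfIdentityProofs using (module Decidable⇒UIP)
open import Relation.Binary.PropositionalEquality using (_≡_; _≢_; refl; sym; trans; cong; subst)
open import Relation.Binary.Construct.Closure.ReflexiveTransitive using (ε; _◅_; _◅◅_; reverse)
open import Relation.Nullary using (¬_; yes; no; ¬?)
open import Relation.Unary using (Decidable; Irrelevant)

-- Σ A P has n elements, counting points of A rather than proofs of P.
Enumerates : {A : Set} → (A → Set) → ℕ → Set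
Enumerates {A} P n = Σ (Σ A P → Fin n) λ f →
  (∀ k → ∃ λ u → f u ≡ k) × (∀ u v → f u ≡ f v → proj₁ u ≡ proj₁ v)

module _ {m : ℕ} {Q : Fin (suc m) → Set} {n : ℕ} where

  enumerates-suc-yes : Q fzero → Enumerates (λ a → Q (fsuc a)) n → Enumerates Q (suc n)
  enumerates-suc-yes q₀ (g , onto , inj) = f , f-onto , f-inj
    where
    f : Σ _ Q → Fin (suc n)
    f (fzero , _) = fzero
    f (fsuc a , q) = fsuc (g (a , q))
    f-onto : ∀ k → ∃ λ u → f u ≡ k
    f-onto fzero = (fzero , q₀) , refl
    f-onto (fsuc k) with onto k
    ... | (a , q) , e = (fsuc a , q) , cong fsuc e
    f-inj : ∀ u v → f u ≡ f v → proj₁ u ≡ proj₁ v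
    f-inj (fzero , _) (fzero , _) _ = refl
    f-inj (fsuc a , p) (fsuc b , q) e = cong fsuc (inj (a , p) (b , q) (suc-injective e))

  enumerates-suc-no : ¬ Q fzero → Enumerates (λ a → Q (fsuc a)) n → Enumerates Q n
  enumerates-suc-no ¬q₀ (g , onto , inj) = f , f-onto , f-inj
    where
    f : Σ _ Q → Fin n
    f (fzero , q) = ⊥-elim (¬q₀ q)
    f (fsuc a , q) = g (a , q)
    f-onto : ∀ k → ∃ λ u → f u ≡ k
    f-onto k with onto k
    ... | (a , q) , e = (fsuc a , q) , e
    f-inj : ∀ u v → f u ≡ f v → proj₁ u ≡ proj₁ v
    f-inj (fzero , p) _ _ = ⊥-elim (¬q₀ p)
    f-inj (fsuc a , _) (fzero , q) _ = ⊥-elim (¬q₀ q)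
    f-inj (fsuc a , p) (fsuc b , q) e = cong fsuc (inj (a , p) (b , q) e)

enumerate-Fin : ∀ m (Q : Fin m → Set) → Decidable Q → ∃ λ n → n ≤ m × Enumerates Q n
enumerate-Fin zero Q Q? = 0 , z≤n , (λ ()) , (λ ()) , (λ ())
enumerate-Fin (suc m) Q Q? with enumerate-Fin m (λ a → Q (fsuc a)) (λ a → Q? (fsuc a)) | Q? fzero
... | n , n≤m , en | yes q₀ = suc n , s≤s n≤m , enumerates-suc-yes q₀ en
... | n , n≤m , en | no ¬q₀ = n , ≤-trans n≤m (n≤1+n m) , enumerates-suc-no ¬q₀ en

module _ {V : Set} (E : Graph V) {P : V → Set} where

  hasComponents-empty : (∀ v → ¬ P v) → HasComponents E P 0
  hasComponents-empty ¬P = (λ u → ⊥-elim (¬P _ (proj₂ u))) , (λ ())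
                         , (λ u → ⊥-elim (¬P _ (proj₂ u))) , (λ u → ⊥-elim (¬P _ (proj₂ u)))

  hasComponents-edgeless : (∀ u v → ¬ InducedAdj E P u v) → Irrelevant P →
                           ∀ {n} → Enumerates P n → HasComponents E P n
  hasComponents-edgeless edgeless P-irr (f , onto , inj) = f , onto , joined , separated
    where
    joined : ∀ u v → f u ≡ f v → Connected E P u v
    joined (u , p) (v , q) e with inj (u , p) (v , q) e
    ... | refl rewrite P-irr p q = ε
    separated : ∀ u v → Connected E P u v → f u ≡ f v
    separated u .u ε = refl
    separated u v (_◅_ {j = w} adj _) = ⊥-elim (edgeless u w adj)

  hasComponents-connected : Σ V P → (∀ u v → Connected E P u v) → HasComponents E P 1
  hasComponents-connected u₀ conn = (λ _ → fzero) , (λ { fzero → u₀ , refl })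
                                  , (λ u v _ → conn u v) , (λ _ _ _ → refl)

module _ {V : Set} {ℓ : ℕ} (c : V → Fin ℓ) {vs : List V} (vs-complete : ∀ v → v ∈ vs) where

  open import Data.List.Membership.DecPropositional (_≟_ {ℓ}) using (_∈?_)
  open import Data.List.Relation.Unary.Unique.DecPropositional.Properties (_≟_ {ℓ}) using (deduplicate-!)

  markingSequence-extending : (xs : List (Fin ℓ)) → Unique xs → (∀ x → x ∈ xs → ∃ λ v → c v ≡ x) →
                              ∃ λ rest → IsMarkingSequence c (xs ++ rest)
  markingSequence-extending xs xs! xs-image = rest , unique , image , complete
    where
    new? : Decidable (λ z → ¬ z ∈ xs)
    new? z = ¬? (z ∈? xs)
    colours = deduplicate _≟_ (map c vs)
    rest = filter new? colours
    unique : Unique (xs ++ rest)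
    unique = ++⁺ xs! (filter⁺ new? (deduplicate-! (map c vs)))
                 (λ (z∈xs , z∈rest) → proj₂ (∈-filter⁻ new? {xs = colours} z∈rest) z∈xs)
    image : ∀ z → z ∈ xs ++ rest → ∃ λ v → c v ≡ z
    image z z∈ with ∈-++⁻ xs z∈
    ... | inj₁ z∈xs = xs-image z z∈xs
    ... | inj₂ z∈rest with ∈-map⁻ c (∈-deduplicate⁻ _≟_ (map c vs) (proj₁ (∈-filter⁻ new? {xs = colours} z∈rest)))
    ...   | v , _ , e = v , sym e
    complete : ∀ v → c v ∈ xs ++ rest
    complete v with c v ∈? xs
    ... | yes cv∈xs = ∈-++⁺ˡ cv∈xs
    ... | no cv∉xs = ∈-++⁺ʳ xs (∈-filter⁺ new? (∈-deduplicate⁺ _≟_ (∈-map⁺ c (vs-complete v))) cv∉xs)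

minOf-attained : ∀ d → 1 ≤ d → (i : Fin d → ℕ) → ∃ λ j → i j ≡ minOf d i
minOf-attained (suc zero) _ i = fzero , refl
minOf-attained (suc (suc d)) _ i with minOf-attained (suc d) (s≤s z≤n) (λ j → i (fsuc j))
... | j , e with ≤-total (i fzero) (minOf (suc d) (λ j → i (fsuc j)))
...   | inj₁ le = fzero , sym (m≤n⇒m⊓n≡m le)
...   | inj₂ ge = fsuc j , trans e (sym (m≥n⇒m⊓n≡n ge))

distinctFrom : ∀ {d} → 2 ≤ d → (j : Fin d) → ∃ λ j′ → j ≢ j′
distinctFrom (s≤s (s≤s z≤n)) fzero = fsuc fzero , λ ()
distinctFrom (s≤s (s≤s z≤n)) (fsuc j) = fzero , λ ()

module _ {d : ℕ} {i : Fin d → ℕ} where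

  private
    K = KGraph d i

  partVertices : (j : Fin d) → List (KVertex d i)
  partVertices j = map (j ,_) (allFin (i j))

  KVertices : List (KVertex d i)
  KVertices = concatMap partVertices (allFin d)

  ∈-KVertices : ∀ v → v ∈ KVertices
  ∈-KVertices (j , a) = ∈-concatMap⁺ partVertices (Any.map (λ { refl → ∈-map⁺ (j ,_) (∈-allFin a) }) (∈-allFin j))

  sameColour⇒samePart : ∀ {ℓ} {c : KVertex d i → Fin ℓ} → ValidColouring K c →
                        ∀ u v → c u ≡ c v → proj₁ u ≡ proj₁ v
  sameColour⇒samePart valid u v cu≡cv with proj₁ u ≟ proj₁ v
  ... | yes same = same
  ... | no differ = ⊥-elim (valid u v differ cu≡cv)

  KGraph-connected : (P : KVertex d i → Set) {u v : KVertex d i} (pu : P u) (pv : P v) →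
                     proj₁ u ≢ proj₁ v → ∀ w w′ → Connected K P w w′
  KGraph-connected P {u} {v} pu pv u≁v w w′ = toHub w ◅◅ reverse (λ {w} {w′} → adj-sym {w} {w′}) (toHub w′)
    where
    adj-sym : ∀ {w w′} → InducedAdj K P w w′ → InducedAdj K P w′ w
    adj-sym w≁w′ w′≡w = w≁w′ (sym w′≡w)
    toHub : ∀ w → Connected K P w (u , pu)
    toHub ((k , a) , p) with k ≟ proj₁ u
    ... | yes refl = _◅_ {j = v , pv} u≁v ((λ v≡u → u≁v (sym v≡u)) ◅ ε)
    ... | no k≁u = k≁u ◅ ε

  enumerate-part : (j : Fin d) (P : KVertex d i → Set) → Decidable P → (∀ v → P v → proj₁ v ≡ j) →
                   ∃ λ n → n ≤ i j × Enumerates P n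
  enumerate-part j P P? inPart with enumerate-Fin (i j) (λ a → P (j , a)) (λ a → P? (j , a))
  ... | n , n≤ , g , onto , inj = n , n≤ , f , f-onto , f-inj
    where
    label : ∀ v → proj₁ v ≡ j → P v → Fin n
    label (.j , a) refl p = g (a , p)
    label-part : ∀ a (e : j ≡ j) p → label (j , a) e p ≡ g (a , p)
    label-part a refl p = refl
    label-inj : ∀ u v eu ev pu pv → label u eu pu ≡ label v ev pv → u ≡ v
    label-inj (.j , a) (.j , b) refl refl pu pv e = cong (j ,_) (inj (a , pu) (b , pv) e)
    f : Σ _ P → Fin n
    f (v , p) = label v (inPart v p) p
    f-onto : ∀ k → ∃ λ u → f u ≡ k
    f-onto k with onto k
    ... | (a , p) , e = ((j , a) , p) , trans (label-part a (inPart (j , a) p) p) e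
    f-inj : ∀ u v → f u ≡ f v → proj₁ u ≡ proj₁ v
    f-inj (u , pu) (v , pv) = label-inj u v (inPart u pu) (inPart v pv) pu pv

  KGraph-locAtMost-partSize : ∀ {ℓ} (c : KVertex d i → Fin ℓ) → ValidColouring K c →
                      ∀ {j j′} → j ≢ j′ → 1 ≤ i j → 1 ≤ i j′ → LocAtMost K c (i j)
  KGraph-locAtMost-partSize c valid {j} {j′} j≢j′ pos pos′ =
    let rest , marking = markingSequence-extending c ∈-KVertices (x ∷ y ∷ []) xy! xy-image
    in x ∷ y ∷ rest , marking , bounded rest
    where
    u u′ : KVertex d i
    u = j , fromℕ< pos
    u′ = j′ , fromℕ< pos′
    x = c u
    y = c u′
    xy! : Unique (x ∷ y ∷ [])
    xy! = (valid u u′ j≢j′ ∷ []) ∷ [] ∷ []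
    xy-image : ∀ z → z ∈ x ∷ y ∷ [] → ∃ λ v → c v ≡ z
    xy-image z (here refl) = u , refl
    xy-image z (there (here refl)) = u′ , refl
    ColourX : KVertex d i → Set
    ColourX v = c v ∈ x ∷ []
    ColourX-irrelevant : Irrelevant ColourX
    ColourX-irrelevant (here p) (here q) = cong here (Decidable⇒UIP.≡-irrelevant _≟_ p q)
    ColourX-inPart : ∀ v → ColourX v → proj₁ v ≡ j
    ColourX-inPart v (here e) = sameColour⇒samePart valid v u e
    ColourX-edgeless : ∀ v w → ¬ InducedAdj K ColourX v w
    ColourX-edgeless (v , p) (w , q) v≁w = v≁w (trans (ColourX-inPart v p) (sym (ColourX-inPart w q)))
    bounded : ∀ rest → LocSeqAtMost K c (x ∷ y ∷ rest) (i j)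
    bounded _ zero _ = 0 , z≤n , hasComponents-empty K (λ _ ())
    bounded _ (suc zero) _ with enumerate-part j ColourX (λ v → Any.any? (c v ≟_) (x ∷ [])) ColourX-inPart
    ... | n , n≤ , en = n , n≤ , hasComponents-edgeless K ColourX-edgeless ColourX-irrelevant en
    bounded _ (suc (suc k)) _ = 1 , pos , hasComponents-connected K (u , here refl)
                                (KGraph-connected _ (here refl) (there (here refl)) j≢j′)

corollary19 : (d : ℕ) → 2 ≤ d → (i : Fin d → ℕ) → (∀ j → 1 ≤ i j) → (ℓ : ℕ) → (c : KVertex d i → Fin ℓ) → ValidColouring (KGraph d i) c → LocAtMost (KGraph d i) c (minOf d i)
corollary19 d 2≤d i pos ℓ c valid with minOf-attained d (≤-trans (s≤s z≤n) 2≤d) i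
... | j , j-min with distinctFrom 2≤d j
...   | j′ , j≢j′ = subst (LocAtMost (KGraph d i) c) j-min (KGraph-locAtMost-partSize c valid j≢j′ (pos j) (pos j′))
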